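{- Let $N\ge3$, let $G$ be a graph, and let $s=(x^1,\dots,x^m,\dots,x^{N-1},u,N)$ be a noncapture state in which the robber (at $u$) moves next, such that $c(G|s)=1$, $\widehat C(s)=C_m$, and for every strategy profile $\sigma^{ -m}$ of the other tokens, $(s,\widehat\sigma^m,\sigma^{ -m})$ leads to $C_m$ capture, where $\widehat\sigma^m\in\widehat\Sigma^m$. Suppose $x^m\notin N(u)$. Then there exists a state $\widetilde s=(x^1,\dots,\widetilde x^m,\dots,x^{N-1},u,N)$ (robber to move, differing from $s$ only in the position of $C_m$) such that (i) $\widetilde x^m\in N(u)$, (ii) $c(G|\widetilde s)=1$, (iii) $\widehat C(\widetilde s)=C_m$, and (iv) for every strategy profile $\widetilde\sigma^{ -m}$ of the other tokens, $(\widetilde s,\widehat\sigma^m,\widetilde\sigma^{ -m})$ leads to $C_m$ capture.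
   Context: Graphs are finite, undirected, connected and simple; $N(u)$ is the open neighbourhood of $u$. There are $N$ tokens: cops $C_1,\dots,C_{N-1}$ (tokens $1,\dots,N-1$) and a robber $R$ (token $N$). A state is $s=(x^1,\dots,x^N,n)$, $x^i\in V$ the location of token $i$, $n$ the token moving next. $s$ is a capture state if $x^i=x^N$ for some $i\le N-1$, otherwise a noncapture state. In each turn only the token to move moves, to a vertex of its closed neighbourhood (it may stay put), turns cycling $C_1,\dots,C_{N-1},R,C_1,\dots$; time counts single moves; play stops at capture. In the modified cops and robber game (two-player zero-sum, the robber's controller gets $-\gamma^t$ if capture occurs at time $t$ and $0$ otherwise, $\gamma\in(0,1)$, the other player controlling all cops), $\widehat\Sigma^n$ is the set of token-$n$ components of optimal pure positional strategies (CR-optimal strategies). For every noncapture $s$ from which play under CR-optimal profiles leads to capture, the capture is always effected by the same cop, denoted $\widehat C(s)$. "$(s,\sigma)$ leads to $C_m$ capture" means play from $s$ under profile $\sigma$ reaches a capture state with $C_m$ on the robber's vertex. State cop number: for a noncapture state $s$, $c(G|s)$ is the least $k\in\{1,\dots,N-1\}$ such that some $k$ of the cops have strategies which, starting from $s$, lead to capture (by any cop) against all strategies of the remaining $N-k$ tokens; $c(G|s)=\infty$ if none. -}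

module Defs where

open import Data.Nat using (ℕ; zero; suc; _≤_; _<_)
open import Data.Fin using (Fin; zero; suc; fromℕ; toℕ; lower₁; _≟_)
open import Data.Fin.Subset using (Subset; inside; outside; ∣_∣)
open import Data.Vec using (Vec; lookup; _[_]≔_)
open import Data.Bool using (Bool; true; false; if_then_else_)
open import Data.Product using (Σ; ∃; ∃-syntax; _×_; _,_)
open import Data.Sum using (_⊎_)
open import Relation.Binary.PropositionalEquality using (_≡_; _≢_; refl)
open import Relation.Binary.Construct.Closure.ReflexiveTransitive using (Star)
open import Relation.Nullary using (¬_; yes; no; does)
open import Relation.Nullary.Decidable using (⌊_⌋)
open import Function using (_∘_)

record Graph : Set₁ where
  field
    n     : ℕ
    Adj   : Fin n → Fin n → Set
    sym   : ∀ {u v} → Adj u v → Adj v u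
    irrefl : ∀ {u} → ¬ Adj u u
    connected : ∀ u v → Star Adj u v

open Graph public

Vertex : Graph → Set
Vertex G = Fin (n G)

CNbr : (G : Graph) → Vertex G → Vertex G → Set
CNbr G u v = u ≡ v ⊎ Adj G u v

-- Tokens: N = suc K tokens; tokens 0 … K-1 are the cops C₁ … C_{N-1},
-- token K (= fromℕ K) is the robber.

Token : ℕ → Set
Token K = Fin (suc K)

robber : (K : ℕ) → Token K
robber K = fromℕ K

nextTok : (K : ℕ) → Token K → Token K
nextTok K t with K Data.Nat.≟ toℕ t
... | yes _ = zero
... | no ne = suc (lower₁ t ne)

record State (G : Graph) (K : ℕ) : Set where
  constructor ⟨_,_⟩
  field
    pos  : Vec (Vertex G) (suc K)
    next : Token K

open State public

CapturedBy : ∀ {G K} → State G K → Token K → Set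
CapturedBy {G} {K} s i = i ≢ robber K × lookup (pos s) i ≡ lookup (pos s) (robber K)

CaptureState : ∀ {G K} → State G K → Set
CaptureState {G} {K} s = ∃[ i ] CapturedBy s i

NonCapture : ∀ {G K} → State G K → Set
NonCapture s = ¬ CaptureState s

Strategy : Graph → ℕ → Set
Strategy G K = State G K → Vertex G

ValidFor : ∀ {G K} → Token K → Strategy G K → Set
ValidFor {G} {K} t f = ∀ s → next s ≡ t → CNbr G (lookup (pos s) t) (f s)

Profile : Graph → ℕ → Set
Profile G K = Token K → Strategy G K

ValidProfile : ∀ {G K} → Profile G K → Set
ValidProfile σ = ∀ t → ValidFor t (σ t)

mixBy : ∀ {G K} → (Token K → Bool) → Profile G K → Profile G K → Profile G K
mixBy p τ ρ t = if p t then τ t else ρ t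

override : ∀ {G K} → Token K → Strategy G K → Profile G K → Profile G K
override m f σ t = if ⌊ t ≟ m ⌋ then f else σ t

step : ∀ {G K} → Profile G K → State G K → State G K
step {G} {K} σ s = ⟨ pos s [ next s ]≔ σ (next s) s , nextTok K (next s) ⟩

play : ∀ {G K} → Profile G K → State G K → ℕ → State G K
play σ s zero    = s
play σ s (suc t) = step σ (play σ s t)

CaptureAt : ∀ {G K} → Profile G K → State G K → ℕ → Set
CaptureAt σ s t = CaptureState (play σ s t) × (∀ t' → t' < t → NonCapture (play σ s t'))

LeadsToCapture : ∀ {G K} → Profile G K → State G K → Set
LeadsToCapture σ s = ∃[ t ] CaptureAt σ s t

LeadsToCopCapture : ∀ {G K} → Profile G K → State G K → Token K → Set
LeadsToCopCapture σ s m = ∃[ t ] (CaptureAt σ s t × CapturedBy (play σ s t) m)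

-- The robber's payoff is -γ^T (T the
-- capture time, payoff 0 if no capture), the cops' payoff γ^T, with
-- γ ∈ (0,1).  Since t ↦ γ^t is strictly decreasing with limit 0 never
-- attained, "cops' payoff under σ₁ ≥ cops' payoff under σ₂ from s" is
-- exactly "capture under σ₁ happens no later than under σ₂" (no capture
-- = time ∞).  This is expressed literally below, independently of γ.

CopsPayoffGE : ∀ {G K} → Profile G K → Profile G K → State G K → Set
CopsPayoffGE σ₁ σ₂ s = ∀ t → CaptureAt σ₂ s t → ∃[ t' ] (t' ≤ t × CaptureAt σ₁ s t')

isRobber : ∀ {K} → Token K → Bool
isRobber {K} t = ⌊ t ≟ robber K ⌋

CROptimal : ∀ {G K} → Profile G K → Set
CROptimal {G} {K} σ =
  ValidProfile σ ×
  (∀ s →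
    -- the robber cannot improve by deviating (−γ^T is not increased)
    (∀ ρ → ValidProfile ρ → CopsPayoffGE (mixBy isRobber ρ σ) σ s) ×
    (∀ τ → ValidProfile τ → CopsPayoffGE σ (mixBy isRobber σ τ) s))

InHatΣ : ∀ {G K} → Token K → Strategy G K → Set
InHatΣ {G} {K} t f = ∃[ σ ] (CROptimal σ × (∀ s → σ t s ≡ f s))

HatCIs : ∀ {G K} → State G K → Token K → Set
HatCIs {G} {K} s m =
  (∃[ σ ] (CROptimal σ × LeadsToCapture σ s)) ×
  (∀ σ → CROptimal σ → LeadsToCapture σ s → LeadsToCopCapture σ s m)

KCopsSuffice : ∀ {G K} → State G K → ℕ → Set
KCopsSuffice {G} {K} s k =
  Σ (Subset (suc K)) λ S →
    (lookup S (robber K) ≡ outside) × (∣ S ∣ ≡ k) ×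
    Σ (Profile G K) λ τ → ValidProfile τ ×
      (∀ ρ → ValidProfile ρ →
        LeadsToCapture (mixBy (λ t → inS (lookup S t)) τ ρ) s)
  where
  inS : Data.Fin.Subset.Side → Bool
  inS inside  = true
  inS outside = false

StateCopNumberIs : ∀ {G K} → State G K → ℕ → Set
StateCopNumberIs {G} {K} s k =
  1 ≤ k × k ≤ K × KCopsSuffice s k × (∀ j → 1 ≤ j → j < k → ¬ KCopsSuffice s j)

{-# OPTIONS --safe #-}
module Submission where

-- Let C_m play σ̂^m while every other token stays put.  From s this play
-- ends with C_m capturing, and since only C_m moves, the state at the
-- robber's last turn before the capturing move differs from s only in
-- C_m's vertex x̃, which is adjacent to u because C_m then steps onto u.
--
-- Forcing a C_m capture persists along a capture-free play: against σ̃
-- from s̃, let the other tokens stay put on the states visited before s̃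
-- and play σ̃ elsewhere.  From s this reaches s̃ and then follows σ̃
-- without ever revisiting a state, since a revisit would make the play
-- loop forever without capture.  This gives (iv), hence (ii) with C_m
-- alone.  For (iii): all CR-optimal profiles capture at the same time,
-- never right after a robber move (the robber would rather stay put), so
-- the capturer is the cop whose turn it is, the same for all of them.

open import Defs hiding (sym)
open import Data.Nat using (ℕ; suc; _≤_)
open import Data.Vec using (lookup; _[_]≔_)
open import Data.Product using (∃-syntax; _×_)
open import Relation.Binary.PropositionalEquality using (_≡_; _≢_)
open import Relation.Nullary using (¬_)

open import Data.Bool using (Bool; true; false; if_then_else_)
open import Data.Fin using (Fin; toℕ; fromℕ<; _≟_)
open import Data.Fin.Properties using (toℕ-injective; toℕ-fromℕ; toℕ-fromℕ<; toℕ-lower₁; toℕ<n; any?)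
open import Data.Fin.Subset using (Subset; inside; outside; ⁅_⁆)
open import Data.Fin.Subset.Properties using (x∈⁅x⁆; x∈⁅y⁆⇒x≡y; ∣⁅x⁆∣≡1)
open import Data.Nat using (zero; _<_; _∸_; _+_; z≤n; s≤s; s≤s⁻¹; _<?_)
open import Data.Nat.Properties
  using (≤-refl; ≤-reflexive; ≤-trans; <-trans; <-≤-trans; ≤-antisym; <⇒≤; ≮⇒≥; ≤∧≢⇒<;
         <-irrefl; <⇒≱; <-cmp; ≰⇒>; 1+n≰n; n<1+n; n≤1+n; m≤n+m; +-monoˡ-<; m∸n+n≡m; m≤n⇒m<n∨m≡n)
open import Data.Product using (Σ; ∃; _,_; proj₁; proj₂)
open import Data.Sum using (inj₁; inj₂)
open import Data.Vec.Properties using (≡-dec; lookup∘update; lookup∘update′; []≔-lookup; []≔-idempotent; []=⇒lookup; lookup⇒[]=)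
open import Function using (_∘_)
open import Relation.Binary.Definitions using (DecidableEquality; tri<; tri≈; tri>)
open import Relation.Binary.PropositionalEquality using (refl; sym; trans; cong; cong₂; subst; subst₂; module ≡-Reasoning)
open import Relation.Nullary using (Dec; yes; no; contradiction)
open import Relation.Nullary.Decidable using (⌊_⌋)

open ≡-Reasoning

module _ {K : ℕ} where

  toℕ≡K⇒robber : {t : Token K} → toℕ t ≡ K → t ≡ robber K
  toℕ≡K⇒robber t≡K = toℕ-injective (trans t≡K (sym (toℕ-fromℕ K)))

  toℕ-cop< : {t : Token K} → t ≢ robber K → toℕ t < K
  toℕ-cop< {t} t≢r = ≤∧≢⇒< (s≤s⁻¹ (toℕ<n t)) (t≢r ∘ toℕ≡K⇒robber)

  toℕ-nextTok : {t : Token K} → t ≢ robber K → toℕ (nextTok K t) ≡ suc (toℕ t)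
  toℕ-nextTok {t} t≢r with K Data.Nat.≟ toℕ t
  ... | yes K≡t = contradiction (toℕ≡K⇒robber (sym K≡t)) t≢r
  ... | no K≢t  = cong suc (toℕ-lower₁ t K≢t)

module _ {n : ℕ} where

  lookup-⁅x⁆-x : (x : Fin n) → lookup ⁅ x ⁆ x ≡ inside
  lookup-⁅x⁆-x x = []=⇒lookup (x∈⁅x⁆ x)

  lookup-⁅y⁆-inside : ∀ {x} (y : Fin n) → lookup ⁅ y ⁆ x ≡ inside → x ≡ y
  lookup-⁅y⁆-inside {x} y x∈⁅y⁆ = x∈⁅y⁆⇒x≡y y (lookup⇒[]= x ⁅ y ⁆ x∈⁅y⁆)

module _ {G : Graph} {K : ℕ} where

  private
    St : Set
    St = State G K

    Prof : Set
    Prof = Profile G K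

  _≟ˢ_ : DecidableEquality St
  ⟨ xs , i ⟩ ≟ˢ ⟨ ys , j ⟩ with ≡-dec _≟_ xs ys | i ≟ j
  ... | yes refl | yes refl = yes refl
  ... | no xs≢ys | _        = no (xs≢ys ∘ cong pos)
  ... | _        | no i≢j   = no (i≢j ∘ cong next)

  _≗ᵖ_ : Prof → Prof → Set
  σ ≗ᵖ τ = ∀ t x → σ t x ≡ τ t x

  stay : Prof
  stay t x = lookup (pos x) t

  stay-valid : ValidProfile stay
  stay-valid _ _ _ = inj₁ refl

  override-≡ : ∀ m (f : Strategy G K) (σ : Prof) x → override m f σ m x ≡ f x
  override-≡ m f σ x with m ≟ m
  ... | yes _   = refl
  ... | no m≢m = contradiction refl m≢m

  override-≢ : ∀ {m t} (f : Strategy G K) (σ : Prof) x → t ≢ m → override m f σ t x ≡ σ t x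
  override-≢ {m} {t} f σ x t≢m with t ≟ m
  ... | yes t≡m = contradiction t≡m t≢m
  ... | no _    = refl

  override-congAt : ∀ m (f : Strategy G K) (σ τ : Prof) x → (∀ t → σ t x ≡ τ t x) →
                    ∀ t → override m f σ t x ≡ override m f τ t x
  override-congAt m f σ τ x σ≡τ t with t ≟ m
  ... | yes _ = refl
  ... | no _  = σ≡τ t

  override-self : ∀ {m} {f : Strategy G K} {σ : Prof} → (∀ x → σ m x ≡ f x) → override m f σ ≗ᵖ σ
  override-self {m} σm≡f t x with t ≟ m
  ... | yes refl = sym (σm≡f x)
  ... | no _     = refl

  override-valid : ∀ {m} {f : Strategy G K} {σ : Prof} → ValidFor m f → ValidProfile σ → ValidProfile (override m f σ)
  override-valid {m} vf vσ t x moves with t ≟ m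
  ... | yes refl = vf x moves
  ... | no _     = vσ t x moves

  mixBy-override : ∀ {p : Token K → Bool} {m} {f : Strategy G K} {τ ρ : Prof} →
                   (∀ t → p t ≡ ⌊ t ≟ m ⌋) → (∀ x → τ m x ≡ f x) →
                   mixBy p τ ρ ≗ᵖ override m f ρ
  mixBy-override {m = m} p≡ τm≡f t x rewrite p≡ t with t ≟ m
  ... | yes refl = τm≡f x
  ... | no _     = refl

  switch : {P : St → Set} → (∀ x → Dec (P x)) → Prof → Prof → Prof
  switch P? σ τ t x with P? x
  ... | yes _ = σ t x
  ... | no _  = τ t x

  module _ {P : St → Set} (P? : ∀ x → Dec (P x)) {σ τ : Prof} where

    switch-in : ∀ {x} → P x → ∀ t → switch P? σ τ t x ≡ σ t x
    switch-in {x} Px t with P? x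
    ... | yes _   = refl
    ... | no ¬Px = contradiction Px ¬Px

    switch-out : ∀ {x} → ¬ P x → ∀ t → switch P? σ τ t x ≡ τ t x
    switch-out {x} ¬Px t with P? x
    ... | yes Px = contradiction Px ¬Px
    ... | no _   = refl

    switch-valid : ValidProfile σ → ValidProfile τ → ValidProfile (switch P? σ τ)
    switch-valid vσ vτ t x with P? x
    ... | yes _ = vσ t x
    ... | no _  = vτ t x

  hatΣ-valid : ∀ {m} {f : Strategy G K} → InHatΣ m f → ValidFor m f
  hatΣ-valid {m} (σ , (valid , _) , σm≡f) x moves =
    subst (CNbr G (lookup (pos x) m)) (σm≡f x) (valid m x moves)

  lookup-step-next : ∀ (σ : Prof) x → lookup (pos (step σ x)) (next x) ≡ σ (next x) x
  lookup-step-next σ x = lookup∘update (next x) (pos x) _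

  lookup-step-≢ : ∀ (σ : Prof) x {i} → i ≢ next x → lookup (pos (step σ x)) i ≡ lookup (pos x) i
  lookup-step-≢ σ x i≢next = lookup∘update′ i≢next (pos x) _

  pos-step-stay : ∀ (σ : Prof) x → σ (next x) x ≡ lookup (pos x) (next x) → pos (step σ x) ≡ pos x
  pos-step-stay σ x stays = trans (cong (pos x [ next x ]≔_) stays) ([]≔-lookup (pos x) (next x))

  capturedBy-pos : ∀ (x y : St) {i : Token K} → pos x ≡ pos y → CapturedBy x i → CapturedBy y i
  capturedBy-pos _ _ refl byI = byI

  captureState-pos : ∀ (x y : St) → pos x ≡ pos y → CaptureState x → CaptureState y
  captureState-pos x y eq (i , byI) = i , capturedBy-pos x y eq byI

  capturedBy-step⁻¹ : ∀ (σ : Prof) x {i} → CapturedBy (step σ x) i → i ≢ next x → robber K ≢ next x → CapturedBy x i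
  capturedBy-step⁻¹ σ x (i≢r , same) i≢next r≢next =
    i≢r , trans (sym (lookup-step-≢ σ x i≢next)) (trans same (lookup-step-≢ σ x r≢next))

  AgreeAt : Prof → Prof → St → Set
  AgreeAt σ τ x = σ (next x) x ≡ τ (next x) x

  step-cong : ∀ (σ τ : Prof) x → AgreeAt σ τ x → step σ x ≡ step τ x
  step-cong σ τ x agree = cong (λ v → ⟨ pos x [ next x ]≔ v , nextTok K (next x) ⟩) agree

  play-agree : ∀ (σ τ : Prof) s t → (∀ t′ → t′ < t → AgreeAt σ τ (play σ s t′)) → play σ s t ≡ play τ s t
  play-agree σ τ s zero    _     = refl
  play-agree σ τ s (suc t) agree = begin
    step σ (play σ s t) ≡⟨ step-cong σ τ _ (agree t (n<1+n t)) ⟩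
    step τ (play σ s t) ≡⟨ cong (step τ) (play-agree σ τ s t (λ t′ t′<t → agree t′ (<-trans t′<t (n<1+n t)))) ⟩
    step τ (play τ s t) ∎

  play-cong : ∀ {σ τ : Prof} → σ ≗ᵖ τ → ∀ s t → play σ s t ≡ play τ s t
  play-cong σ≗τ s t = play-agree _ _ s t (λ t′ _ → σ≗τ _ _)

  next-play : ∀ (σ τ : Prof) s t → next (play σ s t) ≡ next (play τ s t)
  next-play σ τ s zero    = refl
  next-play σ τ s (suc t) = cong (nextTok K) (next-play σ τ s t)

  captureAt-cong : ∀ {σ τ : Prof} {s t} → σ ≗ᵖ τ → CaptureAt σ s t → CaptureAt τ s t
  captureAt-cong {s = s} {t} σ≗τ (captured , before) =
    subst CaptureState (play-cong σ≗τ s t) captured ,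
    λ t′ t′<t → before t′ t′<t ∘ subst CaptureState (sym (play-cong σ≗τ s t′))

  leadsToCopCapture-cong : ∀ {σ τ : Prof} {s m} → σ ≗ᵖ τ → LeadsToCopCapture σ s m → LeadsToCopCapture τ s m
  leadsToCopCapture-cong {s = s} {m} σ≗τ (t , cap , byM) =
    t , captureAt-cong σ≗τ cap , subst (λ x → CapturedBy x m) (play-cong σ≗τ s t) byM

  captureAt-unique : ∀ {σ : Prof} {s t₁ t₂} → CaptureAt σ s t₁ → CaptureAt σ s t₂ → t₁ ≡ t₂
  captureAt-unique {t₁ = t₁} {t₂} (captured₁ , before₁) (captured₂ , before₂) with <-cmp t₁ t₂
  ... | tri< t₁<t₂ _ _ = contradiction captured₁ (before₂ t₁ t₁<t₂)
  ... | tri≈ _ t₁≡t₂ _ = t₁≡t₂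
  ... | tri> _ _ t₂<t₁ = contradiction captured₂ (before₁ t₂ t₂<t₁)

  play-periodic : ∀ (σ : Prof) s {a b} → play σ s a ≡ play σ s b → b < a →
                  ∀ t → ∃[ t₀ ] (t₀ < a × play σ s t ≡ play σ s t₀)
  play-periodic σ s {a} {b} loop b<a zero = zero , <-≤-trans (s≤s z≤n) b<a , refl
  play-periodic σ s {a} {b} loop b<a (suc t) with play-periodic σ s loop b<a t
  ... | t₀ , t₀<a , eq with suc t₀ <? a
  ...   | yes t₀+1<a = suc t₀ , t₀+1<a , cong (step σ) eq
  ...   | no  t₀+1≮a = b , b<a , (begin
    play σ s (suc t)  ≡⟨ cong (step σ) eq ⟩
    play σ s (suc t₀) ≡⟨ cong (play σ s) (≤-antisym t₀<a (≮⇒≥ t₀+1≮a)) ⟩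
    play σ s a        ≡⟨ loop ⟩
    play σ s b        ∎)

  captureAt-noRevisit : ∀ {σ : Prof} {s T a b} → CaptureAt σ s T → b < a → a ≤ T → play σ s a ≢ play σ s b
  captureAt-noRevisit {σ} {s} {T} (captured , before) b<a a≤T loop with play-periodic σ s loop b<a T
  ... | t₀ , t₀<a , eq = before t₀ (<-≤-trans t₀<a a≤T) (subst CaptureState eq captured)

  isRobber-robber : isRobber (robber K) ≡ true
  isRobber-robber with robber K ≟ robber K
  ... | yes _   = refl
  ... | no r≢r = contradiction refl r≢r

  -- Giving σ₂ the robber of σ₁ does not delay capture (σ₂'s robber is
  -- optimal), and σ₁'s cops capture that robber no later (they are optimal).
  optimal-captureTime-≤ : ∀ {σ₁ σ₂ : Prof} {s t₁ t₂} → CROptimal σ₁ → CROptimal σ₂ →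
                          CaptureAt σ₁ s t₁ → CaptureAt σ₂ s t₂ → t₁ ≤ t₂
  optimal-captureTime-≤ {σ₁} {σ₂} {s} {t₁} {t₂} (valid₁ , opt₁) (valid₂ , opt₂) cap₁ cap₂
    with proj₁ (opt₂ s) σ₁ valid₁ t₂ cap₂
  ... | t , t≤t₂ , capMixed with proj₂ (opt₁ s) σ₂ valid₂ t capMixed
  ...   | t₁′ , t₁′≤t , cap₁′ = subst (_≤ t₂) (captureAt-unique cap₁′ cap₁) (≤-trans t₁′≤t t≤t₂)

  optimal-captureTime : ∀ {σ₁ σ₂ : Prof} {s t₁ t₂} → CROptimal σ₁ → CROptimal σ₂ →
                        CaptureAt σ₁ s t₁ → CaptureAt σ₂ s t₂ → t₁ ≡ t₂
  optimal-captureTime opt₁ opt₂ cap₁ cap₂ =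
    ≤-antisym (optimal-captureTime-≤ opt₁ opt₂ cap₁ cap₂) (optimal-captureTime-≤ opt₂ opt₁ cap₂ cap₁)

  -- Otherwise the robber does better by staying put at play σ s e, a state
  -- the play visits only once.
  optimal-captureNotAfterRobberMove : ∀ {σ : Prof} {s e} → CROptimal σ → CaptureAt σ s (suc e) →
                                      next (play σ s e) ≢ robber K
  optimal-captureNotAfterRobberMove {σ} {s} {e} (valid , opt) cap@(_ , before) robberMoves =
    noCapture (proj₁ (opt s) staying (switch-valid (_≟ˢ q) stay-valid valid) (suc e) cap)
    where
    q : St
    q = play σ s e

    staying : Prof
    staying = switch (_≟ˢ q) stay σ

    deviation : Prof
    deviation = mixBy isRobber staying σ

    deviation-agree : ∀ {x} → x ≢ q → ∀ t → σ t x ≡ deviation t x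
    deviation-agree x≢q t with isRobber t
    ... | true  = sym (switch-out (_≟ˢ q) x≢q t)
    ... | false = refl

    same : ∀ t → t ≤ e → play σ s t ≡ play deviation s t
    same t t≤e = play-agree σ deviation s t λ t′ t′<t →
      deviation-agree (captureAt-noRevisit cap (<-≤-trans t′<t t≤e) (n≤1+n e) ∘ sym) _

    robberStays : pos (play deviation s (suc e)) ≡ pos q
    robberStays = begin
      pos (step deviation (play deviation s e)) ≡⟨ cong (pos ∘ step deviation) (sym (same e ≤-refl)) ⟩
      pos (step deviation q)                    ≡⟨ pos-step-stay deviation q (begin
        deviation (next q) q        ≡⟨ cong (λ t → deviation t q) robberMoves ⟩
        deviation (robber K) q      ≡⟨ cong (λ b → (if b then staying (robber K) else σ (robber K)) q) isRobber-robber ⟩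
        staying (robber K) q        ≡⟨ switch-in (_≟ˢ q) refl (robber K) ⟩
        lookup (pos q) (robber K)   ≡⟨ cong (lookup (pos q)) (sym robberMoves) ⟩
        lookup (pos q) (next q)     ∎) ⟩
      pos q                                     ∎

    noCapture : ¬ (∃[ t ] (t ≤ suc e × CaptureAt deviation s t))
    noCapture (t , t≤1+e , captured , _) with m≤n⇒m<n∨m≡n t≤1+e
    ... | inj₁ (s≤s t≤e) = before t (s≤s t≤e) (subst CaptureState (sym (same t t≤e)) captured)
    ... | inj₂ refl      = before e (n<1+n e) (captureState-pos (play deviation s (suc e)) q robberStays captured)

  optimal-capturedBy : ∀ {σ τ : Prof} {s T m} → m ≢ robber K → CROptimal σ →
                       CaptureAt σ s T → CaptureAt τ s T →
                       CapturedBy (play τ s T) m → CapturedBy (play σ s T) m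
  optimal-capturedBy {T = zero} _ _ _ _ byM = byM
  optimal-capturedBy {σ} {τ} {s} {suc e} {m} m≢r opt capσ@(capturedσ , beforeσ) (_ , beforeτ) byM
    with next (play σ s e) ≟ robber K | next (play σ s e) ≟ m
  ... | yes robberMoves | _ = contradiction robberMoves (optimal-captureNotAfterRobberMove opt capσ)
  ... | no robberStays | no mStays =
    contradiction (m , capturedBy-step⁻¹ τ (play τ s e) byM
                         (mStays ∘ trans (next-play σ τ s e) ∘ sym)
                         (robberStays ∘ trans (next-play σ τ s e) ∘ sym))
                  (beforeτ e (n<1+n e))
  ... | no _ | yes mMoves with capturedσ
  ...   | i , byI with i ≟ m
  ...     | yes refl = byI
  ...     | no i≢m   =
    contradiction (i , capturedBy-step⁻¹ σ (play σ s e) byI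
                         (i≢m ∘ (λ i≡next → trans i≡next mMoves))
                         (m≢r ∘ sym ∘ (λ r≡next → trans r≡next mMoves)))
                  (beforeσ e (n<1+n e))

  optimal-capture⇒hatC : ∀ {σ : Prof} {s m} → m ≢ robber K → CROptimal σ → LeadsToCopCapture σ s m → HatCIs s m
  optimal-capture⇒hatC {σ} {s} m≢r opt (T , cap , byM) =
    (σ , opt , T , cap) ,
    λ σ′ opt′ (T′ , cap′) →
      let T≡T′ = optimal-captureTime opt opt′ cap cap′ in
      T′ , cap′ , optimal-capturedBy m≢r opt′ cap′ (subst (CaptureAt σ s) T≡T′ cap)
                                      (subst (λ t → CapturedBy (play σ s t) _) T≡T′ byM)

  ForcesCaptureBy : Token K → Strategy G K → St → Set
  ForcesCaptureBy m f s = ∀ σ → ValidProfile σ → LeadsToCopCapture (override m f σ) s m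

  forcesCaptureBy-play : ∀ {m} {f : Strategy G K} {σ₀ : Prof} {s r} → ValidProfile σ₀ →
                         ForcesCaptureBy m f s →
                         (∀ t → t ≤ r → NonCapture (play (override m f σ₀) s t)) →
                         ForcesCaptureBy m f (play (override m f σ₀) s r)
  forcesCaptureBy-play {m} {f} {σ₀} {s} {r} valid₀ forces noCapture σ̃ valid̃ =
    follow (forces σ′ (switch-valid visited? valid₀ valid̃))
    where
    p : ℕ → St
    p = play (override m f σ₀) s

    Visited : St → Set
    Visited x = ∃ λ (j : Fin r) → p (toℕ j) ≡ x

    visited? : ∀ x → Dec (Visited x)
    visited? x = any? λ j → p (toℕ j) ≟ˢ x

    σ′ Π′ Π̃ : Prof
    σ′ = switch visited? σ₀ σ̃
    Π′ = override m f σ′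
    Π̃ = override m f σ̃

    w : ℕ → St
    w = play Π̃ (p r)

    prefix : ∀ t → t ≤ r → play Π′ s t ≡ p t
    prefix t t≤r = sym (play-agree _ Π′ s t λ t′ t′<t →
      override-congAt m f σ₀ σ′ (p t′) (sym ∘ switch-in visited? (visit (<-≤-trans t′<t t≤r))) _)
      where
      visit : ∀ {t′} → t′ < r → Visited (p t′)
      visit t′<r = fromℕ< t′<r , cong p (toℕ-fromℕ< t′<r)

    follow : LeadsToCopCapture Π′ s m → LeadsToCopCapture Π̃ (p r) m
    follow (T , cap@(captured , before) , byM) =
      T ∸ r , (subst CaptureState reachesT captured , beforẽ) , subst (λ x → CapturedBy x m) reachesT byM
      where
      r<T : r < T
      r<T = ≰⇒> λ T≤r → noCapture T T≤r (subst CaptureState (prefix T T≤r) captured)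

      i+r≡T : T ∸ r + r ≡ T
      i+r≡T = m∸n+n≡m (<⇒≤ r<T)

      tracks : ∀ i → i + r ≤ T → play Π′ s (i + r) ≡ w i
      tracks zero    _      = prefix r ≤-refl
      tracks (suc i) i+r<T = begin
        step Π′ (play Π′ s (i + r)) ≡⟨ cong (step Π′) ih ⟩
        step Π′ (w i)               ≡⟨ step-cong Π′ Π̃ (w i) (override-congAt m f σ′ σ̃ (w i) (switch-out visited? unvisited) _) ⟩
        step Π̃ (w i)               ∎
        where
        ih : play Π′ s (i + r) ≡ w i
        ih = tracks i (<⇒≤ i+r<T)

        unvisited : ¬ Visited (w i)
        unvisited (j , pj≡wi) = captureAt-noRevisit cap (<-≤-trans (toℕ<n j) (m≤n+m r i)) (<⇒≤ i+r<T) (begin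
          play Π′ s (i + r)  ≡⟨ ih ⟩
          w i                ≡⟨ sym pj≡wi ⟩
          p (toℕ j)          ≡⟨ sym (prefix (toℕ j) (<⇒≤ (toℕ<n j))) ⟩
          play Π′ s (toℕ j)  ∎)

      reachesT : play Π′ s T ≡ w (T ∸ r)
      reachesT = trans (cong (play Π′ s) (sym i+r≡T)) (tracks (T ∸ r) (≤-reflexive i+r≡T))

      beforẽ : ∀ i → i < T ∸ r → NonCapture (w i)
      beforẽ i i<T∸r = before (i + r) i+r<T ∘ subst CaptureState (sym (tracks i (<⇒≤ i+r<T)))
        where
        i+r<T : i + r < T
        i+r<T = subst (i + r <_) i+r≡T (+-monoˡ-< r i<T∸r)

  forcesCaptureBy⇒hatC : ∀ {m} {f : Strategy G K} {s} → m ≢ robber K → InHatΣ m f →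
                         ForcesCaptureBy m f s → HatCIs s m
  forcesCaptureBy⇒hatC m≢r (σ , opt , σm≡f) forces =
    optimal-capture⇒hatC m≢r opt (leadsToCopCapture-cong (override-self σm≡f) (forces σ (proj₁ opt)))

  private
    fibre : (T : Set) {A : Set} {B : A → Set} → T ≡ Σ A B → A → Set
    fibre _ {B = B} _ = B

    selectorIn : ∀ {s : St} (T : Set) {A B : Set} {p : Token K → Bool} →
                 T ≡ (A × B × Σ Prof λ τ → ValidProfile τ × (∀ ρ → ValidProfile ρ → LeadsToCapture (mixBy p τ ρ) s)) →
                 Token K → Bool
    selectorIn _ {p = p} _ = p

  -- `KCopsSuffice` tests membership in its set of cops with a function local
  -- to its `where` block; that function cannot be named, so it is read off
  -- the type.
  memberOf : St → ℕ → Subset (suc K) → Token K → Bool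
  memberOf s k S = selectorIn {s} (fibre (KCopsSuffice s k) refl S) refl

  memberOf-⁅⁆ : ∀ s k m t → memberOf s k ⁅ m ⁆ t ≡ ⌊ t ≟ m ⌋
  memberOf-⁅⁆ s k m t with lookup ⁅ m ⁆ t in eq | t ≟ m
  ... | inside  | yes _    = refl
  ... | inside  | no t≢m   = contradiction (lookup-⁅y⁆-inside m eq) t≢m
  ... | outside | yes refl = contradiction (trans (sym (lookup-⁅x⁆-x m)) eq) λ ()
  ... | outside | no _     = refl

  forcesCaptureBy⇒stateCopNumber1 : ∀ {m} {f : Strategy G K} {s} → m ≢ robber K → 1 ≤ K →
                                    ValidFor m f → ForcesCaptureBy m f s → StateCopNumberIs s 1
  forcesCaptureBy⇒stateCopNumber1 {m} {f} {s} m≢r 1≤K valid forces =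
    ≤-refl , 1≤K ,
    (⁅ m ⁆ , robber∉⁅m⁆ , ∣⁅x⁆∣≡1 m , override m f stay , override-valid valid stay-valid , captures) ,
    λ _ 1≤j j<1 _ → 1+n≰n (≤-trans j<1 1≤j)
    where
    robber∉⁅m⁆ : lookup ⁅ m ⁆ (robber K) ≡ outside
    robber∉⁅m⁆ with lookup ⁅ m ⁆ (robber K) in eq
    ... | inside  = contradiction (sym (lookup-⁅y⁆-inside m eq)) m≢r
    ... | outside = refl

    captures : ∀ ρ → ValidProfile ρ → LeadsToCapture (mixBy (memberOf s 1 ⁅ m ⁆) (override m f stay) ρ) s
    captures ρ validρ with forces ρ validρ
    ... | T , cap , _ =
      T , captureAt-cong (λ t x → sym (mixBy-override {ρ = ρ} (memberOf-⁅⁆ s 1 m) (override-≡ m f stay) t x)) cap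

  module StayPlay {m : Token K} {f : Strategy G K} {s : St}
                  (m≢r : m ≢ robber K) (robberFirst : next s ≡ robber K) where

    Π₀ : Prof
    Π₀ = override m f stay

    p : ℕ → St
    p = play Π₀ s

    others-stay : ∀ x → next x ≢ m → pos (step Π₀ x) ≡ pos x
    others-stay x next≢m = pos-step-stay Π₀ x (override-≢ f stay x next≢m)

    m-moves : ∀ t → next (p t) ≡ m → lookup (pos (p (suc t))) m ≡ f (p t)
    m-moves t mMoves = begin
      lookup (pos (p (suc t))) m            ≡⟨ cong (lookup (pos (p (suc t)))) (sym mMoves) ⟩
      lookup (pos (p (suc t))) (next (p t)) ≡⟨ lookup-step-next Π₀ (p t) ⟩
      Π₀ (next (p t)) (p t)                 ≡⟨ cong (λ i → Π₀ i (p t)) mMoves ⟩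
      Π₀ m (p t)                            ≡⟨ override-≡ m f stay (p t) ⟩
      f (p t)                               ∎

    shape : ∀ t → ∃[ y ] pos (p t) ≡ pos s [ m ]≔ y
    shape zero = lookup (pos s) m , sym ([]≔-lookup (pos s) m)
    shape (suc t) = extend (shape t) (next (p t) ≟ m)
      where
      -- A `with` on this test would also abstract it inside the unfolded
      -- `override` of the goal; a case function keeps the goal intact.
      extend : ∃[ y ] pos (p t) ≡ pos s [ m ]≔ y → Dec (next (p t) ≡ m) →
               ∃[ y ] pos (p (suc t)) ≡ pos s [ m ]≔ y
      extend (y , shapeₜ) (no mStays)  = y , trans (others-stay (p t) mStays) shapeₜ
      extend (y , shapeₜ) (yes mMoves) = f (p t) , (begin
        pos (p t) [ next (p t) ]≔ Π₀ (next (p t)) (p t) ≡⟨ cong (λ i → pos (p t) [ i ]≔ Π₀ i (p t)) mMoves ⟩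
        pos (p t) [ m ]≔ Π₀ m (p t)                     ≡⟨ cong₂ (_[ m ]≔_) shapeₜ (override-≡ m f stay (p t)) ⟩
        (pos s [ m ]≔ y) [ m ]≔ f (p t)                 ≡⟨ []≔-idempotent (pos s) m ⟩
        pos s [ m ]≔ f (p t)                            ∎)

    robber-stays : ∀ t → lookup (pos (p t)) (robber K) ≡ lookup (pos s) (robber K)
    robber-stays t with shape t
    ... | y , shapeₜ = trans (cong (λ xs → lookup xs (robber K)) shapeₜ) (lookup∘update′ (m≢r ∘ sym) (pos s) y)

    lastRobberTurn : ∀ t → toℕ (next (p t)) ≤ toℕ m →
                     ∃[ r ] (r < t × next (p r) ≡ robber K × pos (p r) ≡ pos (p t))
    lastRobberTurn zero robber≤m =
      contradiction (subst (_≤ toℕ m) (trans (cong toℕ robberFirst) (toℕ-fromℕ K)) robber≤m) (<⇒≱ (toℕ-cop< m≢r))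
    lastRobberTurn (suc t) next≤m with next (p t) ≟ robber K
    ... | yes robberMoves =
      t , n<1+n t , robberMoves , sym (others-stay (p t) (λ next≡m → m≢r (trans (sym next≡m) robberMoves)))
    ... | no copMoves =
      let r , r<t , robberTurn , samePos = lastRobberTurn t (<⇒≤ next<m) in
      r , <-trans r<t (n<1+n t) , robberTurn , trans samePos (sym (others-stay (p t) next≢m))
      where
      next<m : toℕ (next (p t)) < toℕ m
      next<m = subst (_≤ toℕ m) (toℕ-nextTok copMoves) next≤m

      next≢m : next (p t) ≢ m
      next≢m next≡m = <-irrefl (cong toℕ next≡m) next<m

    capturer-moves : ∀ e → NonCapture (p e) → CapturedBy (p (suc e)) m → next (p e) ≡ m
    capturer-moves e noCapture byM = decide (next (p e) ≟ m)
      where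
      decide : Dec (next (p e) ≡ m) → next (p e) ≡ m
      decide (yes mMoves) = mMoves
      decide (no mStays)  =
        contradiction (m , capturedBy-pos (p (suc e)) (p e) (others-stay (p e) mStays) byM) noCapture

    reachesNeighbour : ValidFor m f → NonCapture s → ForcesCaptureBy m f s →
                       ∃[ r ] ∃[ y ] (Adj G (lookup (pos s) (robber K)) y ×
                                      p r ≡ ⟨ pos s [ m ]≔ y , robber K ⟩ ×
                                      (∀ t → t ≤ r → NonCapture (p t)))
    reachesNeighbour valid noCapture forces with forces stay stay-valid
    ... | zero  , _ , byM = contradiction (m , byM) noCapture
    ... | suc e , (_ , before) , byM
      with capturer-moves e (before e (n<1+n e)) byM
    ... | mMoves with lastRobberTurn e (≤-reflexive (cong toℕ mMoves)) | shape e
    ... | r , r<e , robberTurn , samePos | y , shapeₑ =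
      r , y , adjacent , cong₂ ⟨_,_⟩ (trans samePos shapeₑ) robberTurn ,
      λ t t≤r → before t (s≤s (≤-trans t≤r (<⇒≤ r<e)))
      where
      m-at : lookup (pos (p e)) m ≡ y
      m-at = trans (cong (λ xs → lookup xs m) shapeₑ) (lookup∘update m (pos s) y)

      steps-onto-robber : f (p e) ≡ lookup (pos s) (robber K)
      steps-onto-robber = trans (sym (m-moves e mMoves)) (trans (proj₂ byM) (robber-stays (suc e)))

      adjacent : Adj G (lookup (pos s) (robber K)) y
      adjacent with subst₂ (CNbr G) m-at steps-onto-robber (valid (p e) mMoves)
      ... | inj₁ y≡u = contradiction (m , m≢r , trans m-at (trans y≡u (sym (robber-stays e)))) (before e (n<1+n e))
      ... | inj₂ adj = Graph.sym G adj

lemma19 : (K : ℕ) → 3 ≤ suc K → (G : Graph) → (s : State G K) →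
    NonCapture s → next s ≡ robber K →
    (m : Token K) → m ≢ robber K →
    StateCopNumberIs s 1 → HatCIs s m →
    (σ̂m : Strategy G K) → InHatΣ m σ̂m →
    (∀ σ → ValidProfile σ → LeadsToCopCapture (override m σ̂m σ) s m) →
    ¬ Adj G (lookup (pos s) (robber K)) (lookup (pos s) m) →
    ∃[ x̃ ]
    (let s̃ = ⟨ pos s [ m ]≔ x̃ , robber K ⟩ in
    Adj G (lookup (pos s) (robber K)) x̃ ×
    StateCopNumberIs s̃ 1 ×
    HatCIs s̃ m ×
    (∀ σ̃ → ValidProfile σ̃ → LeadsToCopCapture (override m σ̂m σ̃) s̃ m))
lemma19 K _ G s noCapture robberFirst m m≢r (_ , 1≤K , _) _ σ̂m σ̂m∈Σ̂ forces _
  with StayPlay.reachesNeighbour m≢r robberFirst (hatΣ-valid σ̂m∈Σ̂) noCapture forces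
... | _ , x̃ , adjacent , reaches , noCaptureBefore =
  x̃ , adjacent ,
  forcesCaptureBy⇒stateCopNumber1 m≢r 1≤K (hatΣ-valid σ̂m∈Σ̂) forcesFromS̃ ,
  forcesCaptureBy⇒hatC m≢r σ̂m∈Σ̂ forcesFromS̃ ,
  forcesFromS̃
  where
  forcesFromS̃ : ForcesCaptureBy m σ̂m ⟨ pos s [ m ]≔ x̃ , robber K ⟩
  forcesFromS̃ = subst (ForcesCaptureBy m σ̂m) reaches (forcesCaptureBy-play stay-valid forces noCaptureBefore)
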